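{- Let $Z=(\{a,b,c,0\},\wedge)$ be the semilattice in which $a\wedge b=b\wedge c=a\wedge c=0$. Then for every natural number $n$ there exist a finite semilattice $X_n$ with $|X_n|\ge n$ and a surjective semilattice homomorphism $f\colon X_n\to Z$ such that $X_n$ is an $f$-core.
   Context: A retraction $r\colon X\to X$ is a homomorphism with $r\circ r=r$; it respects $f\colon X\to Z$ if $f\circ r=f$. Given $f\colon X\to Z$, an algebra $A$ is an $f$-core of $X$ if $A$ is minimal with respect to the existence of a retraction $r\colon X\to X$ onto $A$ respecting $f$; $X$ is an \emph{$f$-core} if it is its own $f$-core. -}

module Defs where

open import Data.Nat using (ℕ)
open import Data.Fin using (Fin)
open import Data.Product using (Σ; ∃; _×_)
open import Relation.Binary.PropositionalEquality using (_≡_)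
open import Algebra.Core using (Op₂)
import Algebra.Lattice.Structures as LS

data Z : Set where
  a b c 𝟎 : Z

_∧Z_ : Z → Z → Z
a ∧Z a = a
b ∧Z b = b
c ∧Z c = c
_ ∧Z _ = 𝟎

IsFinSemilattice : (m : ℕ) → Op₂ (Fin m) → Set
IsFinSemilattice m _∙_ = LS.IsSemilattice {A = Fin m} _≡_ _∙_

IsHomToZ : {m : ℕ} → Op₂ (Fin m) → (Fin m → Z) → Set
IsHomToZ _∙_ f = ∀ x y → f (x ∙ y) ≡ f x ∧Z f y

Surjective : {A B : Set} → (A → B) → Set
Surjective {A} f = ∀ z → ∃ λ x → f x ≡ z

IsEndo : {m : ℕ} → Op₂ (Fin m) → (Fin m → Fin m) → Set
IsEndo _∙_ r = ∀ x y → r (x ∙ y) ≡ r x ∙ r y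

IsRetractionOnto : {m : ℕ} → Op₂ (Fin m) → (Fin m → Fin m) → (Fin m → Set) → Set
IsRetractionOnto _∙_ r A =
  IsEndo _∙_ r × (∀ x → r (r x) ≡ r x)
  × (∀ x → A x → ∃ λ y → r y ≡ x) × (∀ y → A (r y))

Respects : {m : ℕ} → (Fin m → Fin m) → (Fin m → Z) → Set
Respects r f = ∀ x → f (r x) ≡ f x

-- X is an f-core: X is minimal w.r.t. the existence of a retraction
-- X → X onto it respecting f, i.e. whenever there is a retraction onto
-- A ⊆ X respecting f, A is all of X. (X itself admits the identity.)
IsFCore : {m : ℕ} → Op₂ (Fin m) → (Fin m → Z) → Set₁
IsFCore {m} _∙_ f =
  (A : Fin m → Set) (r : Fin m → Fin m) →
  IsRetractionOnto _∙_ r A → Respects r f → ∀ x → A x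

module Submission where

-- X consists of a chain of "levels" 0 < 1 < … < N-1 (N = n + 2) and three
-- kinds of elements: ⟨0,p⟩ and ⟨t(p),p⟩ for every level p, where the type
-- t(p) ∈ {a,b} alternates with the parity of p, and one element ⟨c,N-1⟩.
-- X is a subsemilattice of Z × chain, and f is the first projection.
--
-- The heart of the proof is that X is
-- f-rigid: an endomorphism R respecting f fixes the unique element of type c,
-- hence (meeting with it) acts on levels monotonically; since it preserves
-- the alternating types it strictly increases consecutive levels, so it is
-- the identity on levels and therefore on X.

open import Defs
open import Data.Bool using (Bool; true; false) renaming (_∧_ to _and_)
import Data.Bool.Properties as Bool
open import Data.Nat using (ℕ; zero; suc; _+_; _∸_; _≤_; _<_; _⊓_; z≤n; s≤s; s≤s⁻¹)
import Data.Nat.Properties as ℕ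
open import Data.Fin using (Fin; zero; suc; toℕ; fromℕ; fromℕ<; splitAt; join; _↑ˡ_; _↑ʳ_)
open import Data.Fin.Properties
  using (toℕ-injective; toℕ-fromℕ<; toℕ<n; splitAt-↑ˡ; splitAt-↑ʳ; join-splitAt)
open import Data.Product using (Σ; _×_; _,_; proj₁; proj₂; uncurry)
open import Data.Sum using (_⊎_; inj₁; inj₂)
import Data.Sum as Sum
open import Data.Unit using (⊤; tt)
open import Data.Empty using (⊥-elim)
open import Relation.Nullary using (¬_)
open import Relation.Binary.PropositionalEquality
open import Algebra.Core using (Op₂)
import Algebra.Lattice.Structures as LS

isSemilattice : {A : Set} {_∙_ : Op₂ A} →
  (∀ x y z → (x ∙ y) ∙ z ≡ x ∙ (y ∙ z)) → (∀ x y → x ∙ y ≡ y ∙ x) →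
  (∀ x → x ∙ x ≡ x) → LS.IsSemilattice _≡_ _∙_
isSemilattice {_∙_ = _∙_} assoc comm idem = record
  { isBand = record
    { isSemigroup = record
      { isMagma = record { isEquivalence = isEquivalence ; ∙-cong = cong₂ _∙_ }
      ; assoc = assoc }
    ; idem = idem }
  ; comm = comm }

pullback : {A S : Set} {_∧_ : Op₂ A} {_⊓ₛ_ : Op₂ S} →
  LS.IsSemilattice _≡_ _⊓ₛ_ → (e : A → S) → (∀ {x y} → e x ≡ e y → x ≡ y) →
  (∀ x y → e (x ∧ y) ≡ e x ⊓ₛ e y) → LS.IsSemilattice _≡_ _∧_
pullback {_∧_ = _∧_} {_⊓ₛ_} S e e-injective e-hom = isSemilattice ∧-assoc ∧-comm ∧-idem
  where
  open LS.IsSemilattice _≡_ S using (assoc; comm; idem)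
  open ≡-Reasoning

  ∧-assoc : ∀ x y z → (x ∧ y) ∧ z ≡ x ∧ (y ∧ z)
  ∧-assoc x y z = e-injective (begin
    e ((x ∧ y) ∧ z)        ≡⟨ e-hom (x ∧ y) z ⟩
    e (x ∧ y) ⊓ₛ e z       ≡⟨ cong (_⊓ₛ e z) (e-hom x y) ⟩
    (e x ⊓ₛ e y) ⊓ₛ e z    ≡⟨ assoc (e x) (e y) (e z) ⟩
    e x ⊓ₛ (e y ⊓ₛ e z)    ≡⟨ cong (e x ⊓ₛ_) (sym (e-hom y z)) ⟩
    e x ⊓ₛ e (y ∧ z)       ≡⟨ sym (e-hom x (y ∧ z)) ⟩
    e (x ∧ (y ∧ z))        ∎)

  ∧-comm : ∀ x y → x ∧ y ≡ y ∧ x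
  ∧-comm x y = e-injective (begin
    e (x ∧ y)     ≡⟨ e-hom x y ⟩
    e x ⊓ₛ e y    ≡⟨ comm (e x) (e y) ⟩
    e y ⊓ₛ e x    ≡⟨ sym (e-hom y x) ⟩
    e (y ∧ x)     ∎)

  ∧-idem : ∀ x → x ∧ x ≡ x
  ∧-idem x = e-injective (trans (e-hom x x) (idem (e x)))

pairwise : {A B : Set} → Op₂ A → Op₂ B → Op₂ (A × B)
pairwise _∙_ _∘_ p q = (proj₁ p ∙ proj₁ q , proj₂ p ∘ proj₂ q)

×-isSemilattice : {A B : Set} {_∙_ : Op₂ A} {_∘_ : Op₂ B} →
  LS.IsSemilattice _≡_ _∙_ → LS.IsSemilattice _≡_ _∘_ →
  LS.IsSemilattice _≡_ (pairwise _∙_ _∘_)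
×-isSemilattice SA SB = isSemilattice
  (λ x y z → cong₂ _,_ (A.assoc _ _ _) (B.assoc _ _ _))
  (λ x y → cong₂ _,_ (A.comm _ _) (B.comm _ _))
  (λ x → cong₂ _,_ (A.idem _) (B.idem _))
  where
  module A = LS.IsSemilattice _≡_ SA
  module B = LS.IsSemilattice _≡_ SB

-- An f-rigid algebra is an f-core: a retraction respecting f is then the
-- identity, so its image is everything.
rigid⇒fCore : {m : ℕ} (_∙_ : Op₂ (Fin m)) (f : Fin m → Z) →
  (∀ r → IsEndo _∙_ r → Respects r f → ∀ x → r x ≡ x) → IsFCore _∙_ f
rigid⇒fCore _∙_ f rigid A r (endo , _ , _ , image⊆A) respects x =
  subst A (rigid r endo respects x) (image⊆A x)

chain-rigid : ∀ {N} (σ : Fin N → Fin N) →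
  (∀ i j → suc (toℕ i) ≡ toℕ j → toℕ (σ i) < toℕ (σ j)) → ∀ i → σ i ≡ i
chain-rigid {N} σ step i =
  toℕ-injective (ℕ.≤-antisym (below (N ∸ suc (toℕ i)) i (ℕ.m+[n∸m]≡n (toℕ<n i)))
                             (above (toℕ i) i refl))
  where
  -- Climbing from level 0: each step up raises σ by at least one.
  above : ∀ k p → toℕ p ≡ k → k ≤ toℕ (σ p)
  above zero    p _  = z≤n
  above (suc k) p eq = ℕ.≤-trans (s≤s (above k q tq)) (step q p (trans (cong suc tq) (sym eq)))
    where
    k<N : k < N
    k<N = ℕ.<-trans (ℕ.n<1+n k) (subst (_< N) eq (toℕ<n p))
    q : Fin N
    q = fromℕ< k<N
    tq : toℕ q ≡ k
    tq = toℕ-fromℕ< k<N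

  -- Descending from the top level N-1, which lies d steps above p.
  below : ∀ d p → suc (toℕ p + d) ≡ N → toℕ (σ p) ≤ toℕ p
  below zero    p eq = s≤s⁻¹ (subst (toℕ (σ p) <_)
                               (trans (sym eq) (cong suc (ℕ.+-identityʳ (toℕ p)))) (toℕ<n (σ p)))
  below (suc d) p eq = s≤s⁻¹ (ℕ.≤-trans (step p q (sym tq)) (subst (toℕ (σ q) ≤_) tq (below d q eq′)))
    where
    p+1<N : suc (toℕ p) < N
    p+1<N = subst (suc (toℕ p) <_) eq (s≤s (ℕ.m<m+n (toℕ p) (s≤s z≤n)))
    q : Fin N
    q = fromℕ< p+1<N
    tq : toℕ q ≡ suc (toℕ p)
    tq = toℕ-fromℕ< p+1<N
    eq′ : suc (toℕ q + d) ≡ N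
    eq′ = trans (cong (λ k → suc (k + d)) tq) (trans (cong suc (sym (ℕ.+-suc (toℕ p) d))) eq)

-- Z is the subsemilattice {000, 100, 010, 001} of the Boolean cube.
Cube : Set
Cube = Bool × Bool × Bool

encode : Z → Cube
encode a = true  , false , false
encode b = false , true  , false
encode c = false , false , true
encode 𝟎 = false , false , false

decode : Cube → Z
decode (true  , _     , _)     = a
decode (false , true  , _)     = b
decode (false , false , true)  = c
decode (false , false , false) = 𝟎

decode-encode : ∀ x → decode (encode x) ≡ x
decode-encode a = refl
decode-encode b = refl
decode-encode c = refl
decode-encode 𝟎 = refl

encode-injective : ∀ {x y} → encode x ≡ encode y → x ≡ y
encode-injective {x} {y} eq =
  trans (sym (decode-encode x)) (trans (cong decode eq) (decode-encode y))

_∧³_ : Op₂ Cube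
_∧³_ = pairwise _and_ (pairwise _and_ _and_)

encode-hom : ∀ x y → encode (x ∧Z y) ≡ encode x ∧³ encode y
encode-hom 𝟎 y = refl
encode-hom a a = refl
encode-hom a b = refl
encode-hom a c = refl
encode-hom a 𝟎 = refl
encode-hom b a = refl
encode-hom b b = refl
encode-hom b c = refl
encode-hom b 𝟎 = refl
encode-hom c a = refl
encode-hom c b = refl
encode-hom c c = refl
encode-hom c 𝟎 = refl

∧Z-isSemilattice : LS.IsSemilattice _≡_ _∧Z_
∧Z-isSemilattice = pullback
  (×-isSemilattice Bool.∧-isSemilattice (×-isSemilattice Bool.∧-isSemilattice Bool.∧-isSemilattice))
  encode encode-injective encode-hom

_⊓ᶠ_ : ∀ {N} → Op₂ (Fin N)
zero  ⊓ᶠ _     = zero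
suc i ⊓ᶠ zero  = zero
suc i ⊓ᶠ suc j = suc (i ⊓ᶠ j)

toℕ-⊓ᶠ : ∀ {N} (i j : Fin N) → toℕ (i ⊓ᶠ j) ≡ toℕ i ⊓ toℕ j
toℕ-⊓ᶠ zero    j       = refl
toℕ-⊓ᶠ (suc i) zero    = refl
toℕ-⊓ᶠ (suc i) (suc j) = cong suc (toℕ-⊓ᶠ i j)

⊓ᶠ-isSemilattice : ∀ {N} → LS.IsSemilattice _≡_ (_⊓ᶠ_ {N})
⊓ᶠ-isSemilattice = pullback ℕ.⊓-isSemilattice toℕ toℕ-injective toℕ-⊓ᶠ

⊓ᶠ-sel : ∀ {N} (i j : Fin N) → i ⊓ᶠ j ≡ i ⊎ i ⊓ᶠ j ≡ j
⊓ᶠ-sel i j = Sum.map (λ eq → toℕ-injective (trans (toℕ-⊓ᶠ i j) eq))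
                     (λ eq → toℕ-injective (trans (toℕ-⊓ᶠ i j) eq))
                     (ℕ.⊓-sel (toℕ i) (toℕ j))

⊓ᶠ-fromℕ : ∀ {k} (i : Fin (suc k)) → i ⊓ᶠ fromℕ k ≡ i
⊓ᶠ-fromℕ {k}     zero    = refl
⊓ᶠ-fromℕ {suc k} (suc i) = cong suc (⊓ᶠ-fromℕ i)

≤⇒⊓ᶠ≡ : ∀ {N} {i j : Fin N} → toℕ i ≤ toℕ j → i ⊓ᶠ j ≡ i
≤⇒⊓ᶠ≡ {i = i} {j} le = toℕ-injective (trans (toℕ-⊓ᶠ i j) (ℕ.m≤n⇒m⊓n≡m le))

⊓ᶠ≡⇒≤ : ∀ {N} {i j : Fin N} → i ⊓ᶠ j ≡ i → toℕ i ≤ toℕ j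
⊓ᶠ≡⇒≤ {i = i} {j} eq = ℕ.m⊓n≡m⇒m≤n (trans (sym (toℕ-⊓ᶠ i j)) (cong toℕ eq))

data AB : Z → Set where
  a∈AB : AB a
  b∈AB : AB b

AB-∧c : ∀ {t} → AB t → t ∧Z c ≡ 𝟎
AB-∧c a∈AB = refl
AB-∧c b∈AB = refl

AB-≢c : ∀ {t} → AB t → ¬ (t ≡ c)
AB-≢c a∈AB ()
AB-≢c b∈AB ()

par : ℕ → Z
par zero          = a
par (suc zero)    = b
par (suc (suc k)) = par k

par-AB : ∀ k → AB (par k)
par-AB zero          = a∈AB
par-AB (suc zero)    = b∈AB
par-AB (suc (suc k)) = par-AB k

par-alternates : ∀ k → ¬ (par k ≡ par (suc k))
par-alternates zero          ()
par-alternates (suc zero)    ()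
par-alternates (suc (suc k)) = par-alternates k

module Construction (n : ℕ) where

  -- Number of levels; at least 2, so that both types a and b occur.
  N : ℕ
  N = suc (suc n)

  top : Fin N
  top = fromℕ (suc n)

  -- zo p = ⟨0,p⟩, ab p = ⟨par p, p⟩, ce = ⟨c, top⟩.
  data X : Set where
    zo ab : Fin N → X
    ce    : X

  ty : X → Z
  ty (zo p) = 𝟎
  ty (ab p) = par (toℕ p)
  ty ce     = c

  lvl : X → Fin N
  lvl (zo p) = p
  lvl (ab p) = p
  lvl ce     = top

  embed : X → Z × Fin N
  embed x = ty x , lvl x

  Valid : Z → Fin N → Set
  Valid 𝟎 p = ⊤
  Valid a p = par (toℕ p) ≡ a
  Valid b p = par (toℕ p) ≡ b
  Valid c p = p ≡ top

  Valid-AB : ∀ {t} p → AB t → par (toℕ p) ≡ t → Valid t p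
  Valid-AB p a∈AB eq = eq
  Valid-AB p b∈AB eq = eq

  valid : ∀ x → Valid (ty x) (lvl x)
  valid (zo p) = tt
  valid (ab p) = Valid-AB p (par-AB (toℕ p)) refl
  valid ce     = refl

  mk : Z → Fin N → X
  mk 𝟎 p = zo p
  mk a p = ab p
  mk b p = ab p
  mk c p = ce

  embed-mk : ∀ t p → Valid t p → embed (mk t p) ≡ (t , p)
  embed-mk 𝟎 p v = refl
  embed-mk a p v = cong (_, p) v
  embed-mk b p v = cong (_, p) v
  embed-mk c p v = cong (c ,_) (sym v)

  mk-embed : ∀ x → mk (ty x) (lvl x) ≡ x
  mk-embed (zo p) = refl
  mk-embed (ab p) = mk-AB (par-AB (toℕ p))
    where
    mk-AB : ∀ {t} → AB t → mk t p ≡ ab p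
    mk-AB a∈AB = refl
    mk-AB b∈AB = refl
  mk-embed ce     = refl

  embed-injective : ∀ {x y} → embed x ≡ embed y → x ≡ y
  embed-injective {x} {y} eq = trans (sym (mk-embed x)) (trans (cong (uncurry mk) eq) (mk-embed y))

  -- Levels of one type a or b are closed under minimum (it is one of them).
  par-closed : ∀ {t} (p q : Fin N) → par (toℕ p) ≡ t → par (toℕ q) ≡ t → par (toℕ (p ⊓ᶠ q)) ≡ t
  par-closed p q vp vq with ⊓ᶠ-sel p q
  ... | inj₁ eq rewrite eq = vp
  ... | inj₂ eq rewrite eq = vq

  Valid-∧ : ∀ t s {p q} → Valid t p → Valid s q → Valid (t ∧Z s) (p ⊓ᶠ q)
  Valid-∧ 𝟎 s _  _  = tt
  Valid-∧ a a {p} {q} vp vq = par-closed p q vp vq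
  Valid-∧ a b _  _  = tt
  Valid-∧ a c _  _  = tt
  Valid-∧ a 𝟎 _  _  = tt
  Valid-∧ b a _  _  = tt
  Valid-∧ b b {p} {q} vp vq = par-closed p q vp vq
  Valid-∧ b c _  _  = tt
  Valid-∧ b 𝟎 _  _  = tt
  Valid-∧ c a _  _  = tt
  Valid-∧ c b _  _  = tt
  Valid-∧ c c vp vq = trans (cong₂ _⊓ᶠ_ vp vq) (⊓ᶠ-fromℕ top)
  Valid-∧ c 𝟎 _  _  = tt

  _∧_ : Op₂ X
  x ∧ y = mk (ty x ∧Z ty y) (lvl x ⊓ᶠ lvl y)

  embed-hom : ∀ x y → embed (x ∧ y) ≡ pairwise _∧Z_ _⊓ᶠ_ (embed x) (embed y)
  embed-hom x y = embed-mk _ _ (Valid-∧ (ty x) (ty y) (valid x) (valid y))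

  X-isSemilattice : LS.IsSemilattice _≡_ _∧_
  X-isSemilattice =
    pullback (×-isSemilattice ∧Z-isSemilattice ⊓ᶠ-isSemilattice) embed embed-injective embed-hom

  ty-hom : ∀ x y → ty (x ∧ y) ≡ ty x ∧Z ty y
  ty-hom x y = cong proj₁ (embed-hom x y)

  module Rigidity (R : X → X) (R-hom : ∀ x y → R (x ∧ y) ≡ R x ∧ R y)
                  (R-ty : ∀ x → ty (R x) ≡ ty x) where
    open ≡-Reasoning

    σ : Fin N → Fin N
    σ p = lvl (R (ab p))

    R-ce : R ce ≡ ce
    R-ce = c-unique (R ce) (R-ty ce)
      where
      c-unique : ∀ x → ty x ≡ c → x ≡ ce
      c-unique (zo p) ()
      c-unique (ab p) eq = ⊥-elim (AB-≢c (par-AB (toℕ p)) eq)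
      c-unique ce     _  = refl

    R-ab : ∀ p → R (ab p) ≡ ab (σ p)
    R-ab p = ab-shape (R (ab p)) (subst AB (sym (R-ty (ab p))) (par-AB (toℕ p)))
      where
      ab-shape : ∀ x → AB (ty x) → x ≡ ab (lvl x)
      ab-shape (zo q) ()
      ab-shape (ab q) _ = refl
      ab-shape ce     ()

    par-σ : ∀ p → par (toℕ (σ p)) ≡ par (toℕ p)
    par-σ p = trans (cong ty (sym (R-ab p))) (R-ty (ab p))

    ab-∧-ce : ∀ p → ab p ∧ ce ≡ zo p
    ab-∧-ce p = cong₂ mk (AB-∧c (par-AB (toℕ p))) (⊓ᶠ-fromℕ p)

    R-zo : ∀ p → R (zo p) ≡ zo (σ p)
    R-zo p = begin
      R (zo p)        ≡⟨ cong R (sym (ab-∧-ce p)) ⟩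
      R (ab p ∧ ce)   ≡⟨ R-hom (ab p) ce ⟩
      R (ab p) ∧ R ce ≡⟨ cong₂ _∧_ (R-ab p) R-ce ⟩
      ab (σ p) ∧ ce   ≡⟨ ab-∧-ce (σ p) ⟩
      zo (σ p)        ∎

    -- R preserves the order of levels, since zo p ∧ ab q = zo (p ⊓ q).
    σ-mono : ∀ {p q} → toℕ p ≤ toℕ q → toℕ (σ p) ≤ toℕ (σ q)
    σ-mono {p} {q} le = ⊓ᶠ≡⇒≤ (cong lvl (begin
      zo (σ p) ∧ ab (σ q)   ≡⟨ cong₂ _∧_ (sym (R-zo p)) (sym (R-ab q)) ⟩
      R (zo p) ∧ R (ab q)   ≡⟨ sym (R-hom (zo p) (ab q)) ⟩
      R (zo (p ⊓ᶠ q))       ≡⟨ cong (λ r → R (zo r)) (≤⇒⊓ᶠ≡ le) ⟩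
      R (zo p)              ≡⟨ R-zo p ⟩
      zo (σ p)              ∎))

    -- Consecutive levels carry different types, so σ separates them.
    σ-step : ∀ p q → suc (toℕ p) ≡ toℕ q → toℕ (σ p) < toℕ (σ q)
    σ-step p q eq = ℕ.≤∧≢⇒< (σ-mono (subst (toℕ p ≤_) eq (ℕ.n≤1+n (toℕ p)))) λ same →
      par-alternates (toℕ p) (begin
        par (toℕ p)       ≡⟨ sym (par-σ p) ⟩
        par (toℕ (σ p))   ≡⟨ cong par same ⟩
        par (toℕ (σ q))   ≡⟨ par-σ q ⟩
        par (toℕ q)       ≡⟨ cong par (sym eq) ⟩
        par (suc (toℕ p)) ∎)

    R-id : ∀ x → R x ≡ x
    R-id (zo p) = trans (R-zo p) (cong zo (chain-rigid σ σ-step p))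
    R-id (ab p) = trans (R-ab p) (cong ab (chain-rigid σ σ-step p))
    R-id ce     = R-ce

  -- A copy of X on Fin M, listing the zo's, then the ab's, then ce.
  M : ℕ
  M = N + (N + 1)

  index : X → Fin M
  index (zo p) = p ↑ˡ (N + 1)
  index (ab p) = N ↑ʳ (p ↑ˡ 1)
  index ce     = N ↑ʳ (N ↑ʳ zero)

  fromUpper : Fin N ⊎ Fin 1 → X
  fromUpper (inj₁ p) = ab p
  fromUpper (inj₂ _) = ce

  fromSplit : Fin N ⊎ Fin (N + 1) → X
  fromSplit (inj₁ p) = zo p
  fromSplit (inj₂ j) = fromUpper (splitAt N j)

  element : Fin M → X
  element i = fromSplit (splitAt N i)

  element-index : ∀ x → element (index x) ≡ x
  element-index (zo p) rewrite splitAt-↑ˡ N p (N + 1) = refl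
  element-index (ab p) rewrite splitAt-↑ʳ N (N + 1) (p ↑ˡ 1) | splitAt-↑ˡ N p 1 = refl
  element-index ce     rewrite splitAt-↑ʳ N (N + 1) (N ↑ʳ zero) | splitAt-↑ʳ N 1 zero = refl

  index-element : ∀ i → index (element i) ≡ i
  index-element i = trans (index-fromSplit (splitAt N i)) (join-splitAt N (N + 1) i)
    where
    index-fromUpper : ∀ s → index (fromUpper s) ≡ N ↑ʳ join N 1 s
    index-fromUpper (inj₁ p)    = refl
    index-fromUpper (inj₂ zero) = refl

    index-fromSplit : ∀ s → index (fromSplit s) ≡ join N (N + 1) s
    index-fromSplit (inj₁ p) = refl
    index-fromSplit (inj₂ j) = trans (index-fromUpper (splitAt N j)) (cong (N ↑ʳ_) (join-splitAt N 1 j))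

  _∙_ : Op₂ (Fin M)
  i ∙ j = index (element i ∧ element j)

  f : Fin M → Z
  f i = ty (element i)

  element-hom : ∀ i j → element (i ∙ j) ≡ element i ∧ element j
  element-hom i j = element-index (element i ∧ element j)

  index-hom : ∀ x y → index (x ∧ y) ≡ index x ∙ index y
  index-hom x y = cong index (sym (cong₂ _∧_ (element-index x) (element-index y)))

  element-injective : ∀ {i j} → element i ≡ element j → i ≡ j
  element-injective {i} {j} eq = trans (sym (index-element i)) (trans (cong index eq) (index-element j))

  ∙-isSemilattice : IsFinSemilattice M _∙_
  ∙-isSemilattice = pullback X-isSemilattice element element-injective element-hom

  f-hom : IsHomToZ _∙_ f
  f-hom i j = trans (cong ty (element-hom i j)) (ty-hom (element i) (element j))

  f-surjective : Surjective f
  f-surjective a = index (ab zero)       , cong ty (element-index (ab zero))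
  f-surjective b = index (ab (suc zero)) , cong ty (element-index (ab (suc zero)))
  f-surjective c = index ce              , cong ty (element-index ce)
  f-surjective 𝟎 = index (zo zero)       , cong ty (element-index (zo zero))

  n≤M : n ≤ M
  n≤M = ℕ.≤-trans (ℕ.m≤n+m n 2) (ℕ.m≤m+n N (N + 1))

  -- Rigidity transported to Fin M: conjugate r by the bijection element/index.
  ∙-rigid : ∀ r → IsEndo _∙_ r → Respects r f → ∀ i → r i ≡ i
  ∙-rigid r endo respects i = begin
    r i                       ≡⟨ sym (index-element (r i)) ⟩
    index (element (r i))     ≡⟨ cong (λ j → index (element (r j))) (sym (index-element i)) ⟩
    index (R (element i))     ≡⟨ cong index (Rigidity.R-id R R-hom R-ty (element i)) ⟩
    index (element i)         ≡⟨ index-element i ⟩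
    i                         ∎
    where
    open ≡-Reasoning
    R : X → X
    R x = element (r (index x))

    R-hom : ∀ x y → R (x ∧ y) ≡ R x ∧ R y
    R-hom x y = trans (cong (λ j → element (r j)) (index-hom x y))
                      (trans (cong element (endo (index x) (index y))) (element-hom (r (index x)) (r (index y))))

    R-ty : ∀ x → ty (R x) ≡ ty x
    R-ty x = trans (respects (index x)) (cong ty (element-index x))

mainTheorem10 : (n : ℕ) →
    Σ ℕ λ m → Σ (Op₂ (Fin m)) λ _∙_ → Σ (Fin m → Z) λ f →
      IsFinSemilattice m _∙_ × n ≤ m
      × IsHomToZ _∙_ f × Surjective f × IsFCore _∙_ f
mainTheorem10 n =
  M , _∙_ , f , ∙-isSemilattice , n≤M , f-hom , f-surjective , rigid⇒fCore _∙_ f ∙-rigid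
  where open Construction n
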